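{- Let $\mathbf{k}=(k_1,\ldots,k_r)\in\mathbb{N}^r$, $\mathbf{x}=(x_1,\ldots,x_r)$ with $|x_j|\le1$, $l\in\mathbb{N}_0$ and $n\in\mathbb{N}$. Then \[ \sum_{n\ge n_1>\cdots>n_r>0}\prod_{j=1}^r\frac{x_j^{n_j+l}}{(n_j+l)^{k_j}}=(-1)^r\sum_{j=0}^r(-1)^j\zeta_{n+l}(k_1,\ldots,k_j;x_1,\ldots,x_j)\,\zeta^\star_l(k_r,k_{r-1},\ldots,k_{j+1};x_r,x_{r-1},\ldots,x_{j+1}). \]
   Context: $\zeta_N(k_1,\ldots,k_s;y_1,\ldots,y_s)=\sum_{N\ge n_1>\cdots>n_s\ge1}\prod_i y_i^{n_i}/n_i^{k_i}$ and $\zeta^\star_N(k_1,\ldots,k_s;y_1,\ldots,y_s)=\sum_{N\ge n_1\ge\cdots\ge n_s\ge1}\prod_i y_i^{n_i}/n_i^{k_i}$, with value $1$ for the empty index and empty sums equal to $0$ (e.g. $\zeta^\star_0$ of a nonempty index is $0$). -}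

module Defs where

open import Level using (Level)
open import Data.Nat using (ℕ; zero; suc; _∸_) renaming (_+_ to _+ℕ_)
open import Data.Product using (_×_; _,_)
open import Data.List using (List; []; _∷_)
open import Algebra.Bundles using (CommutativeRing)

-- All definitions are relative to a commutative ring R (the paper: ℂ) and
-- a function inv : ℕ → R giving 1/m (hypothesis on inv is in the theorem).
module MZV {c ℓ : Level} (R : CommutativeRing c ℓ) (inv : ℕ → CommutativeRing.Carrier R) where
  open CommutativeRing R

  ι : ℕ → Carrier
  ι zero = 0#
  ι (suc m) = 1# + ι m

  pow : Carrier → ℕ → Carrier
  pow x zero = 1#
  pow x (suc m) = x * pow x m

  sgn : ℕ → Carrier → Carrier
  sgn zero y = y
  sgn (suc j) y = - sgn j y

  Σ1 : ℕ → (ℕ → Carrier) → Carrier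
  Σ1 zero f = 0#
  Σ1 (suc N) f = Σ1 N f + f (suc N)

  Σ0 : ℕ → (ℕ → Carrier) → Carrier
  Σ0 zero f = f 0
  Σ0 (suc r) f = Σ0 r f + f (suc r)

  term : ℕ × Carrier → ℕ → Carrier
  term (k , x) m = pow x m * pow (inv m) k

  -- index = list of pairs (k_i , y_i)
  -- ζ_N(k_1..k_s; y_1..y_s) = Σ_{N ≥ n_1 > ... > n_s ≥ 1} Π y_i^{n_i}/n_i^{k_i}
  ζ : ℕ → List (ℕ × Carrier) → Carrier
  ζ N [] = 1#
  ζ N (p ∷ ps) = Σ1 N (λ m → term p m * ζ (m ∸ 1) ps)

  ζ⋆ : ℕ → List (ℕ × Carrier) → Carrier
  ζ⋆ N [] = 1#
  ζ⋆ N (p ∷ ps) = Σ1 N (λ m → term p m * ζ⋆ m ps)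

  ζshift : ℕ → ℕ → List (ℕ × Carrier) → Carrier
  ζshift l N [] = 1#
  ζshift l N (p ∷ ps) = Σ1 N (λ m → term p (m +ℕ l) * ζshift l (m ∸ 1) ps)

{-# OPTIONS --safe #-}
-- Shifting all indices by l turns the left-hand side into the strict nested sum
-- ζ⟨ l , n + l ] over chains n + l ≥ n₁ > ⋯ > n_r > l. Write its outermost sum
-- over (l, M] as Σ_{m ≤ M} − Σ_{m ≤ l} and induct on r: by the induction
-- hypothesis (for every M) the first part gives the terms j ≥ 1 of the
-- alternating sum, while the second part is a sum over chains
-- 0 < n₁ ≤ n₂ ≤ ⋯ ≤ n_r ≤ l, i.e. ± ζ⋆_l of the reversed index: the term j = 0.
-- Reading a ζ⋆ sum backwards is a triangular Fubini interchange, done once and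
-- for all with oriented interval sums so that no ordering side conditions occur.
module Submission where

open import Level using (Level)
open import Data.Nat using (ℕ; zero; suc; _∸_; _≤_) renaming (_+_ to _+ℕ_)
open import Data.Vec using (Vec; zip; toList)
open import Data.Vec.Properties using (length-toList)
open import Data.Vec.Relation.Unary.All using (All)
open import Data.List using (List; []; _∷_; [_]; _++_; length; take; drop; reverse)
open import Data.List.Properties using (unfold-reverse)
open import Data.Product using (_×_)
open import Algebra.Bundles using (CommutativeRing)
open import Algebra.Morphism.Structures using (module MonoidMorphisms)
import Algebra.Morphism.Construct.Identity as Identity
import Algebra.Morphism.Construct.Composition as Composition
open import Relation.Binary.PropositionalEquality using (cong; subst)
open import Defs

module _ {c ℓ : Level} (R : CommutativeRing c ℓ) (inv : ℕ → CommutativeRing.Carrier R) where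
  open CommutativeRing R
  open MZV R inv
  open import Algebra.Properties.Ring ring
    using (-‿involutive; -0#≈0#; -‿+-comm; +-inverseʳ-unique; ⁻¹-anti-homo‿-; xyx⁻¹≈y; x≈y⇒x∙y⁻¹≈ε; x∙y⁻¹≈ε⇒x≈y)
  open import Algebra.Properties.CommutativeSemigroup +-commutativeSemigroup using (interchange; xy∙z≈xz∙y)
  open import Algebra.Properties.CommutativeSemigroup *-commutativeSemigroup using (x∙yz≈y∙xz)
  open MonoidMorphisms +-rawMonoid +-rawMonoid using (IsMonoidHomomorphism)
  open import Relation.Binary.Reasoning.Setoid setoid

  module _ {φ : Carrier → Carrier} (hom : IsMonoidHomomorphism φ) where
    open IsMonoidHomomorphism hom

    homo-neg : ∀ x → φ (- x) ≈ - φ x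
    homo-neg x = +-inverseʳ-unique (φ x) (φ (- x)) (begin
      φ x + φ (- x) ≈⟨ homo x (- x) ⟨
      φ (x - x)     ≈⟨ ⟦⟧-cong (-‿inverseʳ x) ⟩
      φ 0#          ≈⟨ ε-homo ⟩
      0#            ∎)

    homo-sgn : ∀ j x → φ (sgn j x) ≈ sgn j (φ x)
    homo-sgn zero    x = refl
    homo-sgn (suc j) x = trans (homo-neg (sgn j x)) (-‿cong (homo-sgn j x))

    Σ1-homo : ∀ N f → φ (Σ1 N f) ≈ Σ1 N (λ m → φ (f m))
    Σ1-homo zero    f = ε-homo
    Σ1-homo (suc N) f = trans (homo _ _) (+-congʳ (Σ1-homo N f))

    Σ0-homo : ∀ r f → φ (Σ0 r f) ≈ Σ0 r (λ j → φ (f j))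
    Σ0-homo zero    f = refl
    Σ0-homo (suc r) f = trans (homo _ _) (+-congʳ (Σ0-homo r f))

  *ˡ-isMonoidHomomorphism : ∀ a → IsMonoidHomomorphism (a *_)
  *ˡ-isMonoidHomomorphism a = record
    { isMagmaHomomorphism = record
      { isRelHomomorphism = record { cong = *-congˡ }
      ; homo = distribˡ a
      }
    ; ε-homo = zeroʳ a
    }

  *ʳ-isMonoidHomomorphism : ∀ a → IsMonoidHomomorphism (_* a)
  *ʳ-isMonoidHomomorphism a = record
    { isMagmaHomomorphism = record
      { isRelHomomorphism = record { cong = *-congʳ }
      ; homo = λ x y → distribʳ a x y
      }
    ; ε-homo = zeroˡ a
    }

  -‿isMonoidHomomorphism : IsMonoidHomomorphism (-_)
  -‿isMonoidHomomorphism = record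
    { isMagmaHomomorphism = record
      { isRelHomomorphism = record { cong = -‿cong }
      ; homo = λ x y → sym (-‿+-comm x y)
      }
    ; ε-homo = -0#≈0#
    }

  sgn-isMonoidHomomorphism : ∀ j → IsMonoidHomomorphism (sgn j)
  sgn-isMonoidHomomorphism zero    = Identity.isMonoidHomomorphism +-rawMonoid refl
  sgn-isMonoidHomomorphism (suc j) =
    Composition.isMonoidHomomorphism trans (sgn-isMonoidHomomorphism j) -‿isMonoidHomomorphism

  sgn-cong : ∀ j {x y} → x ≈ y → sgn j x ≈ sgn j y
  sgn-cong j = IsMonoidHomomorphism.⟦⟧-cong (sgn-isMonoidHomomorphism j)

  sgn-involutive : ∀ j x → sgn j (sgn j x) ≈ x
  sgn-involutive zero    x = refl
  sgn-involutive (suc j) x = begin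
    - sgn j (- sgn j x)   ≈⟨ -‿cong (homo-sgn -‿isMonoidHomomorphism j (sgn j x)) ⟨
    - (- sgn j (sgn j x)) ≈⟨ -‿involutive _ ⟩
    sgn j (sgn j x)       ≈⟨ sgn-involutive j x ⟩
    x                     ∎

  Σ1-cong : ∀ N {f g} → (∀ i → f (suc i) ≈ g (suc i)) → Σ1 N f ≈ Σ1 N g
  Σ1-cong zero    f≈g = refl
  Σ1-cong (suc N) f≈g = +-cong (Σ1-cong N f≈g) (f≈g N)

  Σ1-+ : ∀ N f g → Σ1 N (λ m → f m + g m) ≈ Σ1 N f + Σ1 N g
  Σ1-+ zero    f g = sym (+-identityˡ 0#)
  Σ1-+ (suc N) f g = trans (+-congʳ (Σ1-+ N f g)) (interchange _ _ _ _)

  Σ1-split : ∀ k a f → Σ1 (k +ℕ a) f ≈ Σ1 a f + Σ1 k (λ i → f (i +ℕ a))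
  Σ1-split zero    a f = sym (+-identityʳ _)
  Σ1-split (suc k) a f = trans (+-congʳ (Σ1-split k a f)) (+-assoc _ _ _)

  Σ0-cong : ∀ r {f g} → (∀ j → f j ≈ g j) → Σ0 r f ≈ Σ0 r g
  Σ0-cong zero    f≈g = f≈g 0
  Σ0-cong (suc r) f≈g = +-cong (Σ0-cong r f≈g) (f≈g (suc r))

  Σ0-suc : ∀ r f → Σ0 (suc r) f ≈ f 0 + Σ0 r (λ j → f (suc j))
  Σ0-suc zero    f = refl
  Σ0-suc (suc r) f = trans (+-congʳ (Σ0-suc r f)) (+-assoc _ _ _)

  Σ0-Σ1-comm : ∀ r N (G : ℕ → ℕ → Carrier) →
    Σ0 r (λ j → Σ1 N (G j)) ≈ Σ1 N (λ m → Σ0 r (λ j → G j m))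
  Σ0-Σ1-comm zero    N G = refl
  Σ0-Σ1-comm (suc r) N G = trans (+-congʳ (Σ0-Σ1-comm r N G)) (sym (Σ1-+ N _ _))

  sgn-Σ0-alternating-suc : ∀ r (f : ℕ → Carrier) →
    sgn (suc r) (Σ0 (suc r) (λ j → sgn j (f j)))
      ≈ sgn r (Σ0 r (λ j → sgn j (f (suc j)))) - sgn r (f 0)
  sgn-Σ0-alternating-suc r f = begin
    sgn (suc r) (Σ0 (suc r) (λ j → sgn j (f j)))
      ≈⟨ sgn-cong (suc r) (Σ0-suc r _) ⟩
    sgn (suc r) (f 0 + Σ0 r (λ j → - S j))
      ≈⟨ sgn-cong (suc r) (+-congˡ (Σ0-homo -‿isMonoidHomomorphism r S)) ⟨
    sgn (suc r) (f 0 - Σ0 r S)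
      ≈⟨ IsMonoidHomomorphism.homo (sgn-isMonoidHomomorphism (suc r)) _ _ ⟩
    - sgn r (f 0) - sgn r (- Σ0 r S)
      ≈⟨ +-comm _ _ ⟩
    - sgn r (- Σ0 r S) - sgn r (f 0)
      ≈⟨ +-congʳ (-‿cong (homo-neg (sgn-isMonoidHomomorphism r) _)) ⟩
    - (- sgn r (Σ0 r S)) - sgn r (f 0)
      ≈⟨ +-congʳ (-‿involutive _) ⟩
    sgn r (Σ0 r S) - sgn r (f 0) ∎
    where
    S : ℕ → Carrier
    S j = sgn j (f (suc j))

  -- Σ⟨ a , b ] f is Σ_{a < m ≤ b} f m when a ≤ b and
  -- - Σ⟨ b , a ] f otherwise, so that the rules below need no side conditions.
  Σ⟨_,_] : ℕ → ℕ → (ℕ → Carrier) → Carrier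
  Σ⟨ a , b ] f = Σ1 b f - Σ1 a f

  Σ⟨⟩-cong : ∀ a b {f g} → (∀ m → f m ≈ g m) → Σ⟨ a , b ] f ≈ Σ⟨ a , b ] g
  Σ⟨⟩-cong a b f≈g = +-cong (Σ1-cong b (λ i → f≈g (suc i))) (-‿cong (Σ1-cong a (λ i → f≈g (suc i))))

  Σ⟨⟩-homo : ∀ {φ} → IsMonoidHomomorphism φ → ∀ a b f → φ (Σ⟨ a , b ] f) ≈ Σ⟨ a , b ] (λ m → φ (f m))
  Σ⟨⟩-homo hom a b f = trans (IsMonoidHomomorphism.homo hom _ _)
    (+-cong (Σ1-homo hom b f) (trans (homo-neg hom _) (-‿cong (Σ1-homo hom a f))))

  Σ⟨⟩-+ : ∀ a b f g → Σ⟨ a , b ] (λ m → f m + g m) ≈ Σ⟨ a , b ] f + Σ⟨ a , b ] g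
  Σ⟨⟩-+ a b f g = begin
    Σ1 b (λ m → f m + g m) - Σ1 a (λ m → f m + g m)
      ≈⟨ +-cong (Σ1-+ b f g) (-‿cong (Σ1-+ a f g)) ⟩
    (Σ1 b f + Σ1 b g) - (Σ1 a f + Σ1 a g)
      ≈⟨ +-congˡ (-‿+-comm _ _) ⟨
    (Σ1 b f + Σ1 b g) + (- Σ1 a f - Σ1 a g)
      ≈⟨ interchange _ _ _ _ ⟩
    Σ⟨ a , b ] f + Σ⟨ a , b ] g ∎

  Σ⟨⟩-self : ∀ a f → Σ⟨ a , a ] f ≈ 0#
  Σ⟨⟩-self a f = -‿inverseʳ (Σ1 a f)

  Σ⟨⟩-suc : ∀ a b f → Σ⟨ a , suc b ] f ≈ Σ⟨ a , b ] f + f (suc b)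
  Σ⟨⟩-suc a b f = xy∙z≈xz∙y _ _ _

  Σ⟨⟩-flip : ∀ a b f → - Σ⟨ b , a ] f ≈ Σ⟨ a , b ] f
  Σ⟨⟩-flip a b f = ⁻¹-anti-homo‿- (Σ1 a f) (Σ1 b f)

  Σ⟨0⟩ : ∀ b f → Σ⟨ 0 , b ] f ≈ Σ1 b f
  Σ⟨0⟩ b f = trans (+-congˡ -0#≈0#) (+-identityʳ _)

  Σ⟨⟩-shift : ∀ k a f → Σ⟨ a , k +ℕ a ] f ≈ Σ1 k (λ i → f (i +ℕ a))
  Σ⟨⟩-shift k a f = trans (+-congʳ (Σ1-split k a f)) (xyx⁻¹≈y _ _)

  same-increments⇒≈ : ∀ (f g δ : ℕ → Carrier) →
    (∀ N → f (suc N) ≈ f N + δ N) → (∀ N → g (suc N) ≈ g N + δ N) →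
    ∀ a → f a ≈ g a → ∀ N → f N ≈ g N
  same-increments⇒≈ f g δ f-suc g-suc a fa≈ga N =
    x∙y⁻¹≈ε⇒x≈y _ _ (trans (d≈d₀ N) (trans (sym (d≈d₀ a)) (x≈y⇒x∙y⁻¹≈ε fa≈ga)))
    where
    d≈d₀ : ∀ N → f N - g N ≈ f 0 - g 0
    d≈d₀ zero    = refl
    d≈d₀ (suc N) = begin
      f (suc N) - g (suc N)      ≈⟨ +-cong (f-suc N) (-‿cong (g-suc N)) ⟩
      (f N + δ N) - (g N + δ N)  ≈⟨ +-congˡ (-‿+-comm _ _) ⟨
      (f N + δ N) + (- g N - δ N) ≈⟨ interchange _ _ _ _ ⟩
      (f N - g N) + (δ N - δ N)  ≈⟨ +-congˡ (-‿inverseʳ (δ N)) ⟩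
      (f N - g N) + 0#           ≈⟨ +-identityʳ _ ⟩
      f N - g N                  ≈⟨ d≈d₀ N ⟩
      f 0 - g 0                  ∎

  -- Both sides are Σ over lo < m′ ≤ m ≤ N. They grow by the same amount when N
  -- increases and both vanish at N = lo, which proves the identity for every lo, N.
  Σ⟨⟩-fubini : ∀ lo N (F : ℕ → ℕ → Carrier) →
    Σ⟨ lo , N ] (λ m → Σ⟨ lo , m ] (F m)) ≈ Σ⟨ lo , N ] (λ m′ → Σ⟨ m′ ∸ 1 , N ] (λ m → F m m′))
  Σ⟨⟩-fubini lo N F = same-increments⇒≈ lhs rhs (λ N → Σ⟨ lo , suc N ] (F (suc N)))
    (λ N → Σ⟨⟩-suc lo N _) rhs-suc lo (trans (Σ⟨⟩-self lo _) (sym (Σ⟨⟩-self lo _))) N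
    where
    Ψ : ℕ → ℕ → Carrier
    Ψ N m′ = Σ⟨ m′ ∸ 1 , N ] (λ m → F m m′)
    lhs rhs : ℕ → Carrier
    lhs N = Σ⟨ lo , N ] (λ m → Σ⟨ lo , m ] (F m))
    rhs N = Σ⟨ lo , N ] (Ψ N)
    rhs-suc : ∀ N → rhs (suc N) ≈ rhs N + Σ⟨ lo , suc N ] (F (suc N))
    rhs-suc N = begin
      Σ⟨ lo , suc N ] (Ψ (suc N))
        ≈⟨ Σ⟨⟩-cong lo (suc N) (λ m′ → Σ⟨⟩-suc (m′ ∸ 1) N _) ⟩
      Σ⟨ lo , suc N ] (λ m′ → Ψ N m′ + F (suc N) m′)
        ≈⟨ Σ⟨⟩-+ lo (suc N) (Ψ N) (F (suc N)) ⟩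
      Σ⟨ lo , suc N ] (Ψ N) + Σ⟨ lo , suc N ] (F (suc N))
        ≈⟨ +-congʳ (Σ⟨⟩-suc lo N (Ψ N)) ⟩
      (Σ⟨ lo , N ] (Ψ N) + Σ⟨ N , N ] (λ m → F m (suc N))) + Σ⟨ lo , suc N ] (F (suc N))
        ≈⟨ +-congʳ (+-congˡ (Σ⟨⟩-self N _)) ⟩
      (Σ⟨ lo , N ] (Ψ N) + 0#) + Σ⟨ lo , suc N ] (F (suc N))
        ≈⟨ +-congʳ (+-identityʳ _) ⟩
      Σ⟨ lo , N ] (Ψ N) + Σ⟨ lo , suc N ] (F (suc N)) ∎

  -- ζ⟨ l , M ] ps  = Σ_{M ≥ n₁ > ⋯ > n_s > l} Π term p_i n_i  and
  -- ζ⋆⟨ lo , N ] ps = Σ_{N ≥ n₁ ≥ ⋯ ≥ n_s > lo} Π term p_i n_i, oriented as Σ⟨_,_].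
  ζ⟨_,_] : ℕ → ℕ → List (ℕ × Carrier) → Carrier
  ζ⟨ l , M ] []       = 1#
  ζ⟨ l , M ] (p ∷ ps) = Σ⟨ l , M ] (λ m → term p m * ζ⟨ l , m ∸ 1 ] ps)

  ζ⋆⟨_,_] : ℕ → ℕ → List (ℕ × Carrier) → Carrier
  ζ⋆⟨ lo , N ] []       = 1#
  ζ⋆⟨ lo , N ] (p ∷ ps) = Σ⟨ lo , N ] (λ m → term p m * ζ⋆⟨ lo , m ] ps)

  ζshift≈ζ⟨⟩ : ∀ l n ps → ζshift l n ps ≈ ζ⟨ l , n +ℕ l ] ps
  ζshift≈ζ⟨⟩ l n []       = refl
  ζshift≈ζ⟨⟩ l n (p ∷ ps) =
    trans (Σ1-cong n (λ i → *-congˡ (ζshift≈ζ⟨⟩ l i ps))) (sym (Σ⟨⟩-shift n l _))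

  ζ⋆≈ζ⋆⟨0⟩ : ∀ N ps → ζ⋆ N ps ≈ ζ⋆⟨ 0 , N ] ps
  ζ⋆≈ζ⋆⟨0⟩ N []       = refl
  ζ⋆≈ζ⋆⟨0⟩ N (p ∷ ps) =
    trans (Σ1-cong N (λ i → *-congˡ (ζ⋆≈ζ⋆⟨0⟩ (suc i) ps))) (sym (Σ⟨0⟩ N _))

  ζ⋆⟨⟩-snoc : ∀ lo N ps q →
    ζ⋆⟨ lo , N ] (ps ++ [ q ]) ≈ Σ⟨ lo , N ] (λ m′ → term q m′ * ζ⋆⟨ m′ ∸ 1 , N ] ps)
  ζ⋆⟨⟩-snoc lo N []       q = refl
  ζ⋆⟨⟩-snoc lo N (p ∷ ps) q = begin
    Σ⟨ lo , N ] (λ m → term p m * ζ⋆⟨ lo , m ] (ps ++ [ q ]))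
      ≈⟨ Σ⟨⟩-cong lo N (λ m → *-congˡ (ζ⋆⟨⟩-snoc lo m ps q)) ⟩
    Σ⟨ lo , N ] (λ m → term p m * Σ⟨ lo , m ] (λ m′ → term q m′ * ζ⋆⟨ m′ ∸ 1 , m ] ps))
      ≈⟨ Σ⟨⟩-cong lo N (λ m → Σ⟨⟩-homo (*ˡ-isMonoidHomomorphism (term p m)) lo m _) ⟩
    Σ⟨ lo , N ] (λ m → Σ⟨ lo , m ] (F m))
      ≈⟨ Σ⟨⟩-fubini lo N F ⟩
    Σ⟨ lo , N ] (λ m′ → Σ⟨ m′ ∸ 1 , N ] (λ m → F m m′))
      ≈⟨ Σ⟨⟩-cong lo N (λ m′ → Σ⟨⟩-cong (m′ ∸ 1) N (λ m → x∙yz≈y∙xz _ _ _)) ⟩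
    Σ⟨ lo , N ] (λ m′ → Σ⟨ m′ ∸ 1 , N ] (λ m → term q m′ * (term p m * ζ⋆⟨ m′ ∸ 1 , m ] ps)))
      ≈⟨ Σ⟨⟩-cong lo N (λ m′ → Σ⟨⟩-homo (*ˡ-isMonoidHomomorphism (term q m′)) (m′ ∸ 1) N _) ⟨
    Σ⟨ lo , N ] (λ m′ → term q m′ * ζ⋆⟨ m′ ∸ 1 , N ] (p ∷ ps)) ∎
    where
    F : ℕ → ℕ → Carrier
    F m m′ = term p m * (term q m′ * ζ⋆⟨ m′ ∸ 1 , m ] ps)

  ζ⋆⟨⟩-reverse : ∀ lo N qs → ζ⋆⟨ lo , N ] (reverse qs) ≈ sgn (length qs) (ζ⟨ N , lo ] qs)
  ζ⋆⟨⟩-reverse lo N []       = refl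
  ζ⋆⟨⟩-reverse lo N (q ∷ qs) = begin
    ζ⋆⟨ lo , N ] (reverse (q ∷ qs))
      ≡⟨ cong ζ⋆⟨ lo , N ] (unfold-reverse q qs) ⟩
    ζ⋆⟨ lo , N ] (reverse qs ++ [ q ])
      ≈⟨ ζ⋆⟨⟩-snoc lo N (reverse qs) q ⟩
    Σ⟨ lo , N ] (λ m′ → term q m′ * ζ⋆⟨ m′ ∸ 1 , N ] (reverse qs))
      ≈⟨ Σ⟨⟩-cong lo N (λ m′ → *-congˡ (ζ⋆⟨⟩-reverse (m′ ∸ 1) N qs)) ⟩
    Σ⟨ lo , N ] (λ m′ → term q m′ * sgn r (ζ⟨ N , m′ ∸ 1 ] qs))
      ≈⟨ Σ⟨⟩-cong lo N (λ m′ → homo-sgn (*ˡ-isMonoidHomomorphism (term q m′)) r _) ⟩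
    Σ⟨ lo , N ] (λ m′ → sgn r (g m′))
      ≈⟨ Σ⟨⟩-homo (sgn-isMonoidHomomorphism r) lo N g ⟨
    sgn r (Σ⟨ lo , N ] g)
      ≈⟨ sgn-cong r (Σ⟨⟩-flip lo N g) ⟨
    sgn r (- Σ⟨ N , lo ] g)
      ≈⟨ homo-neg (sgn-isMonoidHomomorphism r) _ ⟩
    sgn (suc r) (ζ⟨ N , lo ] (q ∷ qs)) ∎
    where
    r : ℕ
    r = length qs
    g : ℕ → Carrier
    g m′ = term q m′ * ζ⟨ N , m′ ∸ 1 ] qs

  ζ⋆-reverse-∷ : ∀ l p ps →
    ζ⋆ l (reverse (p ∷ ps)) ≈ sgn (length ps) (Σ1 l (λ m → term p m * ζ⟨ l , m ∸ 1 ] ps))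
  ζ⋆-reverse-∷ l p ps = begin
    ζ⋆ l (reverse (p ∷ ps))        ≈⟨ ζ⋆≈ζ⋆⟨0⟩ l (reverse (p ∷ ps)) ⟩
    ζ⋆⟨ 0 , l ] (reverse (p ∷ ps)) ≈⟨ ζ⋆⟨⟩-reverse 0 l (p ∷ ps) ⟩
    - sgn r (0# - Σ1 l g)          ≈⟨ -‿cong (sgn-cong r (+-identityˡ _)) ⟩
    - sgn r (- Σ1 l g)             ≈⟨ -‿cong (homo-neg (sgn-isMonoidHomomorphism r) _) ⟩
    - (- sgn r (Σ1 l g))           ≈⟨ -‿involutive _ ⟩
    sgn r (Σ1 l g)                 ∎
    where
    r : ℕ
    r = length ps
    g : ℕ → Carrier
    g m = term p m * ζ⟨ l , m ∸ 1 ] ps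

  ζ⟨⟩-alternating : ∀ l M ps →
    ζ⟨ l , M ] ps ≈ sgn (length ps) (Σ0 (length ps) (λ j → sgn j (ζ M (take j ps) * ζ⋆ l (reverse (drop j ps)))))
  ζ⟨⟩-alternating l M []       = sym (*-identityˡ 1#)
  ζ⟨⟩-alternating l M (p ∷ ps) = begin
    Σ1 M g - Σ1 l g
      ≈⟨ +-cong leading-sum (-‿cong (trans (sym (sgn-involutive r _)) (sgn-cong r (sym first-term)))) ⟩
    sgn r (Σ0 r (λ j → sgn j (T (suc j)))) - sgn r (T 0)
      ≈⟨ sgn-Σ0-alternating-suc r T ⟨
    sgn (suc r) (Σ0 (suc r) (λ j → sgn j (T j))) ∎
    where
    r : ℕ
    r = length ps
    g : ℕ → Carrier
    g m = term p m * ζ⟨ l , m ∸ 1 ] ps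
    A : ℕ → ℕ → Carrier
    A j m = ζ (m ∸ 1) (take j ps)
    Z : ℕ → Carrier
    Z j = ζ⋆ l (reverse (drop j ps))
    T : ℕ → Carrier
    T j = ζ M (take j (p ∷ ps)) * ζ⋆ l (reverse (drop j (p ∷ ps)))
    first-term : T 0 ≈ sgn r (Σ1 l g)
    first-term = trans (*-identityˡ _) (ζ⋆-reverse-∷ l p ps)
    summand : ∀ j m → term p m * sgn j (A j m * Z j) ≈ sgn j ((term p m * A j m) * Z j)
    summand j m = trans (homo-sgn (*ˡ-isMonoidHomomorphism (term p m)) j _) (sgn-cong j (sym (*-assoc _ _ _)))
    leading-sum : Σ1 M g ≈ sgn r (Σ0 r (λ j → sgn j (T (suc j))))
    leading-sum = begin
      Σ1 M g
        ≈⟨ Σ1-cong M (λ i → *-congˡ (ζ⟨⟩-alternating l i ps)) ⟩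
      Σ1 M (λ m → term p m * sgn r (Σ0 r (λ j → sgn j (A j m * Z j))))
        ≈⟨ Σ1-cong M (λ i → homo-sgn (*ˡ-isMonoidHomomorphism (term p (suc i))) r _) ⟩
      Σ1 M (λ m → sgn r (term p m * Σ0 r (λ j → sgn j (A j m * Z j))))
        ≈⟨ Σ1-cong M (λ i → sgn-cong r (trans (Σ0-homo (*ˡ-isMonoidHomomorphism (term p (suc i))) r _)
             (Σ0-cong r (λ j → summand j (suc i))))) ⟩
      Σ1 M (λ m → sgn r (Σ0 r (λ j → sgn j ((term p m * A j m) * Z j))))
        ≈⟨ Σ1-homo (sgn-isMonoidHomomorphism r) M _ ⟨
      sgn r (Σ1 M (λ m → Σ0 r (λ j → sgn j ((term p m * A j m) * Z j))))
        ≈⟨ sgn-cong r (Σ0-Σ1-comm r M _) ⟨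
      sgn r (Σ0 r (λ j → Σ1 M (λ m → sgn j ((term p m * A j m) * Z j))))
        ≈⟨ sgn-cong r (Σ0-cong r (λ j → sym (trans (sgn-cong j (Σ1-homo (*ʳ-isMonoidHomomorphism (Z j)) M _))
             (Σ1-homo (sgn-isMonoidHomomorphism j) M _)))) ⟩
      sgn r (Σ0 r (λ j → sgn j (T (suc j)))) ∎

open import Data.Nat using (_+_)

-- The identity is formal: it holds for every inv, every ks and every n.
theorem4p3 : ∀ {c ℓ : Level} (R : CommutativeRing c ℓ) (inv : ℕ → CommutativeRing.Carrier R)
    → (∀ m → 1 ≤ m → CommutativeRing._≈_ R (CommutativeRing._*_ R (inv m) (MZV.ι R inv m)) (CommutativeRing.1# R))
    → (r : ℕ) (ks : Vec ℕ r) (xs : Vec (CommutativeRing.Carrier R) r) (l n : ℕ)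
    → All (1 ≤_) ks → 1 ≤ n
    → CommutativeRing._≈_ R
        (MZV.ζshift R inv l n (toList (zip ks xs)))
        (MZV.sgn R inv r (MZV.Σ0 R inv r (λ j → MZV.sgn R inv j
          (CommutativeRing._*_ R
            (MZV.ζ R inv (n + l) (take j (toList (zip ks xs))))
            (MZV.ζ⋆ R inv l (reverse (drop j (toList (zip ks xs)))))))))
theorem4p3 R inv _ r ks xs l n _ _ =
  subst (λ s → ζshift l n L ≈ sgn s (Σ0 s (λ j → sgn j (ζ (n + l) (take j L) * ζ⋆ l (reverse (drop j L))))))
    (length-toList (zip ks xs))
    (CommutativeRing.trans R (ζshift≈ζ⟨⟩ R inv l n L) (ζ⟨⟩-alternating R inv l (n + l) L))
  where
  open CommutativeRing R using (_≈_; _*_)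
  open MZV R inv
  L : List (ℕ × CommutativeRing.Carrier R)
  L = toList (zip ks xs)
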